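{- Let $n\ge2$ and $r\ge1$ be integers, and let $X_{n,r}$ be the size of $\rho^{r}(\tau)$ for a uniformly random Catalan--Stanley tree $\tau$ of size $n$. Then \[ \mathbb{E}X_{n,r} = \frac{1}{C_{n-2}}\binom{2n-2r-4}{n-2} + 1, \] where $C_m=\frac{1}{m+1}\binom{2m}{m}$ and $\binom{m}{j}$ is taken to be $0$ unless $0\le j\le m$.
   Context: A rooted plane tree has ordered children at every node; its size is its number of nodes. For each child $c$ of the root, the rightmost leaf of the branch at $c$ is the leaf reached from $c$ by repeatedly moving to the rightmost child. A Catalan--Stanley tree is a rooted plane tree in which every such rightmost leaf has odd distance to the root (the one-node tree is included); there are $C_{n-2}$ of size $n\ge 2$. The reduction $\rho$: for each rightmost leaf $\ell$ of a branch attached to the root, if $\ell$ is a child of the root it is deleted; otherwise all descendants of the grandparent of $\ell$ are deleted (the grandparent becomes a leaf); the one-node tree is mapped to itself. -}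

module Defs where

open import Data.Nat using (ℕ; zero; suc; _+_; _*_; _∸_; _/_; _≡ᵇ_)
open import Data.Nat.Combinatorics using (_C_)
open import Data.Integer using (ℤ; +_; -[1+_])
open import Data.List using (List; []; _∷_; mapMaybe)
open import Data.List.Relation.Unary.All using (All)
open import Data.Maybe using (Maybe; just; nothing)
open import Data.Bool using (if_then_else_)
open import Data.Product using (∃-syntax)
open import Relation.Binary.PropositionalEquality using (_≡_)

data Tree : Set where
  node : List Tree → Tree

mutual
  size : Tree → ℕ
  size (node ts) = suc (sizeF ts)

  sizeF : List Tree → ℕ
  sizeF [] = 0
  sizeF (t ∷ ts) = size t + sizeF ts

-- distance from a node v to the leaf reached from v by repeatedly
-- moving to the rightmost child
mutual
  rdepth : Tree → ℕ
  rdepth (node ts) = rdepthL ts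

  rdepthL : List Tree → ℕ
  rdepthL [] = 0
  rdepthL (t ∷ []) = suc (rdepth t)
  rdepthL (_ ∷ u ∷ ts) = rdepthL (u ∷ ts)

Odd : ℕ → Set
Odd d = ∃[ k ] d ≡ suc (2 * k)

-- Catalan–Stanley tree: for every child c of the root, the rightmost leaf
-- of the branch at c has odd distance (= 1 + rdepth c) to the root.
CatalanStanley : Tree → Set
CatalanStanley (node ts) = All (λ c → Odd (suc (rdepth c))) ts

-- cut v: along the rightmost path from v, the node g whose rightmost leaf
-- is at distance exactly 2 (i.e. the grandparent of the rightmost leaf)
-- has all its descendants deleted (g becomes a leaf).
mutual
  cut : Tree → Tree
  cut (node ts) = if rdepthL ts ≡ᵇ 2 then node [] else node (cutL ts)

  cutL : List Tree → List Tree
  cutL [] = []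
  cutL (t ∷ []) = cut t ∷ []
  cutL (t ∷ u ∷ ts) = t ∷ cutL (u ∷ ts)

-- reduction of one branch at a child c of the root:
-- nothing = the branch (a leaf child of the root) is deleted
reduceBranch : Tree → Maybe Tree
reduceBranch (node []) = nothing
reduceBranch (node (t ∷ ts)) = just (cut (node (t ∷ ts)))

-- the reduction ρ (the one-node tree is mapped to itself)
ρ : Tree → Tree
ρ (node ts) = node (mapMaybe reduceBranch ts)

ρ^ : ℕ → Tree → Tree
ρ^ zero t = t
ρ^ (suc r) t = ρ (ρ^ r t)

-- binomial with integer top; 0 unless 0 ≤ j ≤ m
-- (stdlib _C_ already gives 0 when j > m)
binomℤ : ℤ → ℕ → ℕ
binomℤ (+ m) j = m C j
binomℤ -[1+ _ ] _ = 0

catalan : ℕ → ℕ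
catalan m = ((2 * m) C m) / suc m

module Submission where

-- A Catalan–Stanley tree of size m + 2 is encoded by a plane forest
-- of size m (there are Catalan many): the forest is cut at its leaves into
-- segments, each segment becomes one root branch, and each non-leaf tree
-- node (node φ ∷ b) of a segment becomes two levels of the rightmost path of
-- that branch (a "step").  Since ρ removes the last step of every branch, the
-- size of ρ^r of the encoded tree is 1 + firstInternal r f + weighted r f for
-- two simple statistics of the forest f.  These are summed over all forests
-- of size m with generating functions: the decomposition f = node g ∷ h
-- gives functional equations in terms of the counting series Cat, whence
-- ∑ (firstInternal r + weighted r) = [x^m] x^(2r) Cat^(2r) (1 - 4x)^(-1/2),
-- whose coefficients are the binomials C(2m - 2r, m).

module FormalSeries where

  open import Data.Nat using (ℕ; zero; suc; _+_; _*_; _≤_; _<_; z≤n; s≤s)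
  open import Data.Nat.Properties
  open import Algebra.Properties.CommutativeSemigroup +-commutativeSemigroup
    using (interchange; x∙yz≈y∙xz)
  open import Level using (0ℓ)
  open import Relation.Binary.Bundles using (Setoid)
  import Relation.Binary.Reasoning.Setoid as SetoidReasoning
  open import Relation.Binary.PropositionalEquality
  open ≡-Reasoning

  Seq : Set
  Seq = ℕ → ℕ

  infix 4 _≐_
  _≐_ : Seq → Seq → Set
  f ≐ g = ∀ n → f n ≡ g n

  infixl 6 _⊕_
  infixl 7 _⋆_
  infix 8 _·_

  _⊕_ : Seq → Seq → Seq
  (f ⊕ g) n = f n + g n

  tail : Seq → Seq
  tail f n = f (suc n)

  _⋆_ : Seq → Seq → Seq
  (f ⋆ g) zero = f 0 * g 0
  (f ⋆ g) (suc n) = f 0 * g (suc n) + (tail f ⋆ g) n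

  X : Seq → Seq
  X f zero = 0
  X f (suc n) = f n

  𝟘 𝟙 : Seq
  𝟘 _ = 0
  𝟙 zero = 1
  𝟙 (suc _) = 0

  _·_ : ℕ → Seq → Seq
  (c · f) n = c * f n

  ≐-refl : ∀ {f} → f ≐ f
  ≐-refl n = refl

  ≐-sym : ∀ {f g} → f ≐ g → g ≐ f
  ≐-sym p n = sym (p n)

  ≐-trans : ∀ {f g h} → f ≐ g → g ≐ h → f ≐ h
  ≐-trans p q n = trans (p n) (q n)

  ≐-setoid : Setoid 0ℓ 0ℓ
  ≐-setoid = record
    { Carrier = Seq
    ; _≈_ = _≐_
    ; isEquivalence = record { refl = ≐-refl ; sym = ≐-sym ; trans = ≐-trans }
    }

  module ≐-Reasoning = SetoidReasoning ≐-setoid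

  ⊕-cong : ∀ {f f′ g g′} → f ≐ f′ → g ≐ g′ → f ⊕ g ≐ f′ ⊕ g′
  ⊕-cong p q n = cong₂ _+_ (p n) (q n)

  X-cong : ∀ {f g} → f ≐ g → X f ≐ X g
  X-cong p zero = refl
  X-cong p (suc n) = p n

  ⋆-agreeˡ : ∀ {f f′} g n → (∀ i → i ≤ n → f i ≡ f′ i) → (f ⋆ g) n ≡ (f′ ⋆ g) n
  ⋆-agreeˡ g zero h = cong (_* g 0) (h 0 z≤n)
  ⋆-agreeˡ g (suc n) h = cong₂ _+_ (cong (_* g (suc n)) (h 0 z≤n))
    (⋆-agreeˡ g n (λ i i≤n → h (suc i) (s≤s i≤n)))

  ⋆-agreeʳ : ∀ f {g g′} n → (∀ i → i ≤ n → g i ≡ g′ i) → (f ⋆ g) n ≡ (f ⋆ g′) n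
  ⋆-agreeʳ f zero h = cong (f 0 *_) (h 0 z≤n)
  ⋆-agreeʳ f (suc n) h = cong₂ _+_ (cong (f 0 *_) (h (suc n) ≤-refl))
    (⋆-agreeʳ (tail f) n (λ i i≤n → h i (m≤n⇒m≤1+n i≤n)))

  ⋆-congˡ : ∀ {f f′} g → f ≐ f′ → f ⋆ g ≐ f′ ⋆ g
  ⋆-congˡ g p n = ⋆-agreeˡ g n (λ i _ → p i)

  ⋆-congʳ : ∀ f {g g′} → g ≐ g′ → f ⋆ g ≐ f ⋆ g′
  ⋆-congʳ f p n = ⋆-agreeʳ f n (λ i _ → p i)

  ⋆-zeroˡ : ∀ g → 𝟘 ⋆ g ≐ 𝟘
  ⋆-zeroˡ g zero = refl
  ⋆-zeroˡ g (suc n) = ⋆-zeroˡ g n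

  ⋆-identityˡ : ∀ g → 𝟙 ⋆ g ≐ g
  ⋆-identityˡ g zero = +-identityʳ (g 0)
  ⋆-identityˡ g (suc n) = begin
    (g (suc n) + 0) + (𝟘 ⋆ g) n ≡⟨ cong₂ _+_ (+-identityʳ (g (suc n))) (⋆-zeroˡ g n) ⟩
    g (suc n) + 0               ≡⟨ +-identityʳ (g (suc n)) ⟩
    g (suc n)                   ∎

  ⋆-Xˡ : ∀ f g → X f ⋆ g ≐ X (f ⋆ g)
  ⋆-Xˡ f g zero = refl
  ⋆-Xˡ f g (suc n) = refl

  ⋆-scaleˡ : ∀ c f g → (c · f) ⋆ g ≐ c · (f ⋆ g)
  ⋆-scaleˡ c f g zero = *-assoc c (f 0) (g 0)
  ⋆-scaleˡ c f g (suc n) = begin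
    c * f 0 * g (suc n) + (tail (c · f) ⋆ g) n
      ≡⟨ cong₂ _+_ (*-assoc c (f 0) _) (⋆-scaleˡ c (tail f) g n) ⟩
    c * (f 0 * g (suc n)) + c * (tail f ⋆ g) n
      ≡⟨ *-distribˡ-+ c _ _ ⟨
    c * (f ⋆ g) (suc n) ∎

  ⋆-distribʳ : ∀ f f′ g → (f ⊕ f′) ⋆ g ≐ f ⋆ g ⊕ f′ ⋆ g
  ⋆-distribʳ f f′ g zero = *-distribʳ-+ (g 0) (f 0) (f′ 0)
  ⋆-distribʳ f f′ g (suc n) = begin
    (f 0 + f′ 0) * g (suc n) + ((tail f ⊕ tail f′) ⋆ g) n
      ≡⟨ cong₂ _+_ (*-distribʳ-+ (g (suc n)) (f 0) (f′ 0)) (⋆-distribʳ (tail f) (tail f′) g n) ⟩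
    (f 0 * g (suc n) + f′ 0 * g (suc n)) + ((tail f ⋆ g) n + (tail f′ ⋆ g) n)
      ≡⟨ interchange (f 0 * g (suc n)) _ _ _ ⟩
    (f ⋆ g) (suc n) + (f′ ⋆ g) (suc n) ∎

  ⋆-comm : ∀ f g → f ⋆ g ≐ g ⋆ f
  ⋆-comm f g zero = *-comm (f 0) (g 0)
  ⋆-comm f g (suc zero) = begin
    f 0 * g 1 + f 1 * g 0 ≡⟨ +-comm (f 0 * g 1) _ ⟩
    f 1 * g 0 + f 0 * g 1 ≡⟨ cong₂ _+_ (*-comm (f 1) (g 0)) (*-comm (f 0) (g 1)) ⟩
    g 0 * f 1 + g 1 * f 0 ∎
  ⋆-comm f g (suc (suc n)) = begin
    a + (tail f ⋆ g) (suc n)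
      ≡⟨ cong (a +_) (⋆-comm (tail f) g (suc n)) ⟩
    a + (b + (tail g ⋆ tail f) n)
      ≡⟨ cong (λ z → a + (b + z)) (⋆-comm (tail g) (tail f) n) ⟩
    a + (b + (tail f ⋆ tail g) n)
      ≡⟨ x∙yz≈y∙xz a b _ ⟩
    b + (a + (tail f ⋆ tail g) n)
      ≡⟨ cong (b +_) (⋆-comm f (tail g) (suc n)) ⟩
    b + (tail g ⋆ f) (suc n) ∎
    where a = f 0 * g (2 + n)
          b = g 0 * f (2 + n)

  ⋆-assoc : ∀ f g h → (f ⋆ g) ⋆ h ≐ f ⋆ (g ⋆ h)
  ⋆-assoc f g h zero = *-assoc (f 0) (g 0) (h 0)
  ⋆-assoc f g h (suc n) = begin
    a + ((f 0 · tail g ⊕ tail f ⋆ g) ⋆ h) n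
      ≡⟨ cong (a +_) (⋆-distribʳ (f 0 · tail g) (tail f ⋆ g) h n) ⟩
    a + ((f 0 · tail g ⋆ h) n + ((tail f ⋆ g) ⋆ h) n)
      ≡⟨ cong₂ (λ u v → a + (u + v)) (⋆-scaleˡ (f 0) (tail g) h n) (⋆-assoc (tail f) g h n) ⟩
    a + (f 0 * (tail g ⋆ h) n + (tail f ⋆ (g ⋆ h)) n)
      ≡⟨ +-assoc a _ _ ⟨
    (a + f 0 * (tail g ⋆ h) n) + (tail f ⋆ (g ⋆ h)) n
      ≡⟨ cong (_+ (tail f ⋆ (g ⋆ h)) n) first ⟩
    (f ⋆ (g ⋆ h)) (suc n) ∎
    where
    a = f 0 * g 0 * h (suc n)
    first : a + f 0 * (tail g ⋆ h) n ≡ f 0 * (g ⋆ h) (suc n)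
    first = trans (cong (_+ f 0 * (tail g ⋆ h) n) (*-assoc (f 0) (g 0) _))
                  (sym (*-distribˡ-+ (f 0) _ _))

  ⋆-Xʳ : ∀ f g → f ⋆ X g ≐ X (f ⋆ g)
  ⋆-Xʳ f g = ≐-trans (⋆-comm f (X g)) (≐-trans (⋆-Xˡ g f) (X-cong (⋆-comm g f)))

  ⋆-identityʳ : ∀ g → g ⋆ 𝟙 ≐ g
  ⋆-identityʳ g = ≐-trans (⋆-comm g 𝟙) (⋆-identityˡ g)

  -- A linear recursion Q = A + x·(U ⋆ Q) determines Q uniquely, since the
  -- n-th coefficient of the right-hand side only involves Q i for i < n.
  recursion-unique : ∀ U A Q Q′ → Q ≐ A ⊕ X (U ⋆ Q) → Q′ ≐ A ⊕ X (U ⋆ Q′) → Q ≐ Q′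
  recursion-unique U A Q Q′ e e′ n = upTo n n ≤-refl
    where
    upTo : ∀ n i → i ≤ n → Q i ≡ Q′ i
    upTo n zero _ = trans (e 0) (sym (e′ 0))
    upTo (suc n) (suc i) (s≤s i≤n) = begin
      Q (suc i)                   ≡⟨ e (suc i) ⟩
      A (suc i) + (U ⋆ Q) i       ≡⟨ cong (A (suc i) +_) (⋆-agreeʳ U i (λ j j≤i → upTo n j (≤-trans j≤i i≤n))) ⟩
      A (suc i) + (U ⋆ Q′) i      ≡⟨ e′ (suc i) ⟨
      Q′ (suc i)                  ∎

  _^_ : Seq → ℕ → Seq
  f ^ zero = 𝟙
  f ^ suc k = f ⋆ (f ^ k)

  X^ : ℕ → Seq → Seq
  X^ zero f = f
  X^ (suc j) f = X (X^ j f)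

  X^-cong : ∀ j {f g} → f ≐ g → X^ j f ≐ X^ j g
  X^-cong zero p = p
  X^-cong (suc j) p = X-cong (X^-cong j p)

  X^-X : ∀ j f → X^ j (X f) ≐ X (X^ j f)
  X^-X zero f = ≐-refl
  X^-X (suc j) f = X-cong (X^-X j f)

  ⋆-X^ʳ : ∀ j f g → f ⋆ X^ j g ≐ X^ j (f ⋆ g)
  ⋆-X^ʳ zero f g = ≐-refl
  ⋆-X^ʳ (suc j) f g = ≐-trans (⋆-Xʳ f (X^ j g)) (X-cong (⋆-X^ʳ j f g))

  X^-shifted : ∀ j f m → X^ j f (j + m) ≡ f m
  X^-shifted zero f m = refl
  X^-shifted (suc j) f m = X^-shifted j f m

  X^-low : ∀ j f m → m < j → X^ j f m ≡ 0
  X^-low (suc j) f zero lt = refl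
  X^-low (suc j) f (suc m) (s≤s lt) = X^-low j f m lt

module ListSums where

  open import Data.Nat using (ℕ; zero; suc; _+_; _*_)
  open import Data.Nat.Properties
  open import Algebra.Properties.CommutativeSemigroup +-commutativeSemigroup using (interchange)
  open import Data.Product using (Σ; _×_; _,_; proj₁; proj₂)
  open import Data.Sum using (inj₁; inj₂)
  open import Data.List using (List; []; _∷_; _++_; map; length; cartesianProduct)
  open import Data.List.Properties using (map-++)
  open import Data.Nat.ListAction using (sum)
  open import Data.Nat.ListAction.Properties using (sum-++; sum-↭)
  open import Data.List.Relation.Unary.Any using (here; there)
  open import Data.List.Membership.Propositional using (_∈_)
  open import Data.List.Membership.Propositional.Properties
    using (∈-cartesianProduct⁺; ∈-cartesianProduct⁻; ∈-++⁺ˡ; ∈-++⁺ʳ; ∈-++⁻)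
  open import Data.List.Membership.Propositional.Properties.WithK using (unique∧set⇒bag)
  open import Data.List.Relation.Binary.BagAndSetEquality using (∼bag⇒↭)
  open import Data.List.Relation.Binary.Permutation.Propositional.Properties using (map⁺)
  open import Data.List.Relation.Unary.Unique.Propositional using (Unique)
  import Data.List.Relation.Unary.Unique.Propositional.Properties as Unique
  open import Data.List.Relation.Binary.Disjoint.Propositional using (Disjoint)
  open import Function.Bundles using (_⇔_)
  open import Relation.Binary.PropositionalEquality
  open ≡-Reasoning
  open FormalSeries using (_⋆_)

  ∑ : {A : Set} → (A → ℕ) → List A → ℕ
  ∑ φ xs = sum (map φ xs)

  ∑-unique : {A : Set} (φ : A → ℕ) {xs ys : List A} → Unique xs → Unique ys →
    (∀ {z} → z ∈ xs ⇔ z ∈ ys) → ∑ φ xs ≡ ∑ φ ys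
  ∑-unique φ ux uy same = sum-↭ (map⁺ φ (∼bag⇒↭ (unique∧set⇒bag ux uy same)))

  ∑-++ : {A : Set} (φ : A → ℕ) (xs ys : List A) → ∑ φ (xs ++ ys) ≡ ∑ φ xs + ∑ φ ys
  ∑-++ φ xs ys = trans (cong sum (map-++ φ xs ys)) (sum-++ (map φ xs) (map φ ys))

  ∑-+ : {A : Set} (φ ψ : A → ℕ) (xs : List A) → ∑ (λ a → φ a + ψ a) xs ≡ ∑ φ xs + ∑ ψ xs
  ∑-+ φ ψ [] = refl
  ∑-+ φ ψ (x ∷ xs) = trans (cong (φ x + ψ x +_) (∑-+ φ ψ xs)) (interchange (φ x) (ψ x) _ _)

  ∑-cong : {A : Set} {φ ψ : A → ℕ} (xs : List A) → (∀ a → a ∈ xs → φ a ≡ ψ a) → ∑ φ xs ≡ ∑ ψ xs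
  ∑-cong [] h = refl
  ∑-cong (x ∷ xs) h = cong₂ _+_ (h x (here refl)) (∑-cong xs (λ a a∈ → h a (there a∈)))

  ∑-map : {A B : Set} (φ : B → ℕ) (f : A → B) (xs : List A) → ∑ φ (map f xs) ≡ ∑ (λ a → φ (f a)) xs
  ∑-map φ f [] = refl
  ∑-map φ f (x ∷ xs) = cong (φ (f x) +_) (∑-map φ f xs)

  ∑-count : {A : Set} (xs : List A) → ∑ (λ _ → 1) xs ≡ length xs
  ∑-count [] = refl
  ∑-count (x ∷ xs) = cong suc (∑-count xs)

  ∑-scale : {A : Set} (c : ℕ) (φ : A → ℕ) (xs : List A) → ∑ (λ a → c * φ a) xs ≡ c * ∑ φ xs
  ∑-scale c φ [] = sym (*-zeroʳ c)
  ∑-scale c φ (x ∷ xs) = trans (cong (c * φ x +_) (∑-scale c φ xs)) (sym (*-distribˡ-+ c _ _))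

  ∑-cartesian : {A B : Set} (φ : A → ℕ) (ψ : B → ℕ) (xs : List A) (ys : List B) →
    ∑ (λ p → φ (proj₁ p) * ψ (proj₂ p)) (cartesianProduct xs ys) ≡ ∑ φ xs * ∑ ψ ys
  ∑-cartesian φ ψ [] ys = refl
  ∑-cartesian φ ψ (x ∷ xs) ys = begin
    ∑ w (map (x ,_) ys ++ cartesianProduct xs ys)
      ≡⟨ ∑-++ w (map (x ,_) ys) _ ⟩
    ∑ w (map (x ,_) ys) + ∑ w (cartesianProduct xs ys)
      ≡⟨ cong₂ _+_ (trans (∑-map w (x ,_) ys) (∑-scale (φ x) ψ ys)) (∑-cartesian φ ψ xs ys) ⟩
    φ x * ∑ ψ ys + ∑ φ xs * ∑ ψ ys
      ≡⟨ *-distribʳ-+ (∑ ψ ys) (φ x) _ ⟨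
    (φ x + ∑ φ xs) * ∑ ψ ys ∎
    where w = λ p → φ (proj₁ p) * ψ (proj₂ p)

  -- Given lists EA i, EB j of objects of size i and j, pairs EA EB n lists the
  -- pairs of total size n; it is the combinatorial counterpart of _⋆_.
  pairs : {A B : Set} → (ℕ → List A) → (ℕ → List B) → ℕ → List (A × B)
  pairs EA EB zero = cartesianProduct (EA 0) (EB 0)
  pairs EA EB (suc n) = cartesianProduct (EA 0) (EB (suc n)) ++ pairs (λ i → EA (suc i)) EB n

  ∑-pairs : {A B : Set} (φ : A → ℕ) (ψ : B → ℕ) (EA : ℕ → List A) (EB : ℕ → List B) (n : ℕ) →
    ∑ (λ p → φ (proj₁ p) * ψ (proj₂ p)) (pairs EA EB n)
    ≡ ((λ i → ∑ φ (EA i)) ⋆ (λ j → ∑ ψ (EB j))) n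
  ∑-pairs φ ψ EA EB zero = ∑-cartesian φ ψ (EA 0) (EB 0)
  ∑-pairs φ ψ EA EB (suc n) = trans (∑-++ _ (cartesianProduct (EA 0) (EB (suc n))) _)
    (cong₂ _+_ (∑-cartesian φ ψ (EA 0) (EB (suc n))) (∑-pairs φ ψ (λ i → EA (suc i)) EB n))

  ∈-pairs⁻ : {A B : Set} (EA : ℕ → List A) (EB : ℕ → List B) (n : ℕ) {a : A} {b : B} →
    (a , b) ∈ pairs EA EB n → Σ ℕ λ i → Σ ℕ λ j → (i + j ≡ n) × (a ∈ EA i) × (b ∈ EB j)
  ∈-pairs⁻ EA EB zero m with ∈-cartesianProduct⁻ (EA 0) (EB 0) m
  ... | ma , mb = 0 , 0 , refl , ma , mb
  ∈-pairs⁻ EA EB (suc n) m with ∈-++⁻ (cartesianProduct (EA 0) (EB (suc n))) m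
  ... | inj₁ m′ = let (ma , mb) = ∈-cartesianProduct⁻ (EA 0) (EB (suc n)) m′
                  in 0 , suc n , refl , ma , mb
  ... | inj₂ m′ = let (i , j , e , ma , mb) = ∈-pairs⁻ (λ i → EA (suc i)) EB n m′
                  in suc i , j , cong suc e , ma , mb

  ∈-pairs⁺ : {A B : Set} (EA : ℕ → List A) (EB : ℕ → List B) (i j : ℕ) {a : A} {b : B} →
    a ∈ EA i → b ∈ EB j → (a , b) ∈ pairs EA EB (i + j)
  ∈-pairs⁺ EA EB zero zero ma mb = ∈-cartesianProduct⁺ ma mb
  ∈-pairs⁺ EA EB zero (suc j) ma mb = ∈-++⁺ˡ (∈-cartesianProduct⁺ ma mb)
  ∈-pairs⁺ EA EB (suc i) j ma mb =
    ∈-++⁺ʳ (cartesianProduct (EA 0) (EB (suc (i + j)))) (∈-pairs⁺ (λ i → EA (suc i)) EB i j ma mb)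

  pairs-unique : {A B : Set} (EA : ℕ → List A) (EB : ℕ → List B) →
    (∀ i → Unique (EA i)) → (∀ j → Unique (EB j)) →
    (∀ {i i′ a} → a ∈ EA i → a ∈ EA i′ → i ≡ i′) → ∀ n → Unique (pairs EA EB n)
  pairs-unique EA EB ua ub da zero = Unique.cartesianProduct⁺ (ua 0) (ub 0)
  pairs-unique EA EB ua ub da (suc n) = Unique.++⁺ (Unique.cartesianProduct⁺ (ua 0) (ub (suc n)))
    (pairs-unique (λ i → EA (suc i)) EB (λ i → ua (suc i)) ub (λ m m′ → suc-injective (da m m′)) n)
    disjoint
    where
    disjoint : Disjoint (cartesianProduct (EA 0) (EB (suc n))) (pairs (λ i → EA (suc i)) EB n)
    disjoint (m₁ , m₂) with ∈-cartesianProduct⁻ (EA 0) (EB (suc n)) m₁ | ∈-pairs⁻ (λ i → EA (suc i)) EB n m₂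
    ... | ma , _ | i , j , e , ma′ , _ with da ma ma′
    ... | ()

module Forests where

  open import Defs using (Tree; node; size; sizeF)
  open import Data.Nat using (ℕ; zero; suc; _+_; _*_; _<_; s≤s)
  open import Data.Nat.Properties
  open import Data.Product using (_×_; _,_; proj₁; proj₂)
  open import Data.List using (List; []; _∷_; map)
  open import Data.List.Relation.Unary.Any using (here)
  open import Data.List.Membership.Propositional using (_∈_)
  open import Data.List.Membership.Propositional.Properties using (∈-map⁺; ∈-map⁻)
  open import Data.List.Relation.Unary.Unique.Propositional using (Unique)
  import Data.List.Relation.Unary.Unique.Propositional.Properties as Unique
  import Data.List.Relation.Unary.AllPairs as AllPairs
  import Data.List.Relation.Unary.All as All
  open import Function.Bundles using (mk⇔)
  open import Relation.Binary.PropositionalEquality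
  open ≡-Reasoning
  open FormalSeries using (_⋆_; ⋆-agreeˡ; ⋆-agreeʳ)
  open ListSums

  plant : List Tree × List Tree → List Tree
  plant (g , h) = node g ∷ h

  plant-injective : ∀ {x y} → plant x ≡ plant y → x ≡ y
  plant-injective {g , h} {g′ , h′} refl = refl

  -- forestsᵏ k n lists the forests of size n, provided n < k; the bound k
  -- makes the recursion structural.
  forestsᵏ : ℕ → ℕ → List (List Tree)
  forestsᵏ zero n = []
  forestsᵏ (suc k) zero = [] ∷ []
  forestsᵏ (suc k) (suc n) = map plant (pairs (forestsᵏ k) (forestsᵏ k) n)

  forests : ℕ → List (List Tree)
  forests n = forestsᵏ (suc n) n

  forestsᵏ-size : ∀ k n {f} → f ∈ forestsᵏ k n → sizeF f ≡ n
  forestsᵏ-size (suc k) zero (here refl) = refl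
  forestsᵏ-size (suc k) (suc n) m with ∈-map⁻ plant m
  ... | (g , h) , m′ , refl with ∈-pairs⁻ (forestsᵏ k) (forestsᵏ k) n m′
  ... | i , j , e , mg , mh =
    cong suc (trans (cong₂ _+_ (forestsᵏ-size k i mg) (forestsᵏ-size k j mh)) e)

  forestsᵏ-unique : ∀ k n → Unique (forestsᵏ k n)
  forestsᵏ-unique zero n = AllPairs.[]
  forestsᵏ-unique (suc k) zero = All.[] AllPairs.∷ AllPairs.[]
  forestsᵏ-unique (suc k) (suc n) = Unique.map⁺ plant-injective
    (pairs-unique (forestsᵏ k) (forestsᵏ k) (forestsᵏ-unique k) (forestsᵏ-unique k)
      (λ {i} {i′} m m′ → trans (sym (forestsᵏ-size k i m)) (forestsᵏ-size k i′ m′)) n)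

  forestsᵏ-complete : ∀ k f → sizeF f < k → f ∈ forestsᵏ k (sizeF f)
  forestsᵏ-complete (suc k) [] _ = here refl
  forestsᵏ-complete (suc k) (node g ∷ h) (s≤s lt) = ∈-map⁺ plant
    (∈-pairs⁺ (forestsᵏ k) (forestsᵏ k) (sizeF g) (sizeF h)
      (forestsᵏ-complete k g (≤-trans (s≤s (m≤m+n (sizeF g) (sizeF h))) lt))
      (forestsᵏ-complete k h (≤-trans (s≤s (m≤n+m (sizeF h) (sizeF g))) lt)))

  ∈-forests : ∀ f → f ∈ forests (sizeF f)
  ∈-forests f = forestsᵏ-complete (suc (sizeF f)) f ≤-refl

  forests-unique : ∀ n → Unique (forests n)
  forests-unique n = forestsᵏ-unique (suc n) n

  ∑-forestsᵏ : ∀ (φ : List Tree → ℕ) k n → n < k → ∑ φ (forestsᵏ k n) ≡ ∑ φ (forests n)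
  ∑-forestsᵏ φ k n lt = ∑-unique φ (forestsᵏ-unique k n) (forests-unique n) (mk⇔ to from)
    where
    to : ∀ {f} → f ∈ forestsᵏ k n → f ∈ forests n
    to {f} m = subst (λ z → f ∈ forestsᵏ (suc n) z) (forestsᵏ-size k n m)
      (forestsᵏ-complete (suc n) f (s≤s (≤-reflexive (forestsᵏ-size k n m))))
    from : ∀ {f} → f ∈ forests n → f ∈ forestsᵏ k n
    from {f} m = subst (λ z → f ∈ forestsᵏ k z) (forestsᵏ-size (suc n) n m)
      (forestsᵏ-complete k f (subst (_< k) (sym (forestsᵏ-size (suc n) n m)) lt))

  ∑-forests-plant : ∀ (Φ : List Tree → ℕ) (φ ψ : List Tree → ℕ) n →
    (∀ g h → Φ (plant (g , h)) ≡ φ g * ψ h) →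
    ∑ Φ (forests (suc n)) ≡ ((λ i → ∑ φ (forests i)) ⋆ (λ j → ∑ ψ (forests j))) n
  ∑-forests-plant Φ φ ψ n factor = begin
    ∑ Φ (map plant P)
      ≡⟨ ∑-map Φ plant P ⟩
    ∑ (λ p → Φ (plant p)) P
      ≡⟨ ∑-cong P (λ p _ → factor (proj₁ p) (proj₂ p)) ⟩
    ∑ (λ p → φ (proj₁ p) * ψ (proj₂ p)) P
      ≡⟨ ∑-pairs φ ψ (forestsᵏ (suc n)) (forestsᵏ (suc n)) n ⟩
    ((λ i → ∑ φ (forestsᵏ (suc n) i)) ⋆ (λ j → ∑ ψ (forestsᵏ (suc n) j))) n
      ≡⟨ ⋆-agreeˡ _ n (λ i i≤n → ∑-forestsᵏ φ (suc n) i (s≤s i≤n)) ⟩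
    ((λ i → ∑ φ (forests i)) ⋆ (λ j → ∑ ψ (forestsᵏ (suc n) j))) n
      ≡⟨ ⋆-agreeʳ _ n (λ i i≤n → ∑-forestsᵏ ψ (suc n) i (s≤s i≤n)) ⟩
    ((λ i → ∑ φ (forests i)) ⋆ (λ j → ∑ ψ (forests j))) n ∎
    where P = pairs (forestsᵏ (suc n)) (forestsᵏ (suc n)) n

module Branches where

  open import Defs
  open import Data.Nat using (ℕ; zero; suc; _+_; _*_)
  open import Data.Nat.Properties
  open import Data.Nat.Solver using (module +-*-Solver)
  open +-*-Solver using (solve; _:+_; _:*_; _:=_; con)
  open import Data.Maybe using (Maybe; just; nothing; maybe)
  open import Data.Product using (_×_; _,_)
  open import Data.Empty using (⊥-elim)
  open import Data.List using (List; []; _∷_; map; length; mapMaybe; _∷ʳ_)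
  open import Relation.Binary.PropositionalEquality
  open ≡-Reasoning
  open ListSums using (∑; ∑-cong)

  -- A branch whose rightmost path has even length 2k is described by k steps.
  -- A step (φ , b) covers two levels of the rightmost path: a node with
  -- children φ ∷ʳ c, where c has children b ∷ʳ (the rest of the branch).
  Step : Set
  Step = List Tree × List Tree

  branch : List Step → Tree
  branch [] = node []
  branch ((φ , b) ∷ ps) = node (φ ∷ʳ node (b ∷ʳ branch ps))

  stepSize : Step → ℕ
  stepSize (φ , b) = suc (suc (sizeF φ + sizeF b))

  sizeF-snoc : ∀ xs t → sizeF (xs ∷ʳ t) ≡ sizeF xs + size t
  sizeF-snoc [] t = +-identityʳ (size t)
  sizeF-snoc (x ∷ xs) t = trans (cong (size x +_) (sizeF-snoc xs t)) (sym (+-assoc (size x) _ _))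

  rdepthL-snoc : ∀ xs t → rdepthL (xs ∷ʳ t) ≡ suc (rdepth t)
  rdepthL-snoc [] t = refl
  rdepthL-snoc (x ∷ []) t = refl
  rdepthL-snoc (x ∷ y ∷ xs) t = rdepthL-snoc (y ∷ xs) t

  cutL-snoc : ∀ xs t → cutL (xs ∷ʳ t) ≡ xs ∷ʳ cut t
  cutL-snoc [] t = refl
  cutL-snoc (x ∷ []) t = refl
  cutL-snoc (x ∷ y ∷ xs) t = cong (x ∷_) (cutL-snoc (y ∷ xs) t)

  rdepth-branch : ∀ ps → rdepth (branch ps) ≡ length ps + length ps
  rdepth-branch [] = refl
  rdepth-branch ((φ , b) ∷ ps) = begin
    rdepthL (φ ∷ʳ node (b ∷ʳ branch ps)) ≡⟨ rdepthL-snoc φ _ ⟩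
    suc (rdepthL (b ∷ʳ branch ps))        ≡⟨ cong suc (rdepthL-snoc b _) ⟩
    suc (suc (rdepth (branch ps)))        ≡⟨ cong (λ z → suc (suc z)) (rdepth-branch ps) ⟩
    suc (suc (length ps + length ps))     ≡⟨ cong suc (+-suc (length ps) _) ⟨
    suc (length ps + suc (length ps))     ∎

  cut-grandparent : ∀ xs t → rdepth t ≡ 1 → cut (node (xs ∷ʳ t)) ≡ node []
  cut-grandparent xs t e rewrite rdepthL-snoc xs t | e = refl

  cut-descend : ∀ xs t → rdepth t ≢ 1 → cut (node (xs ∷ʳ t)) ≡ node (xs ∷ʳ cut t)
  cut-descend xs t ne rewrite rdepthL-snoc xs t | cutL-snoc xs t with rdepth t
  ... | zero = refl
  ... | suc zero = ⊥-elim (ne refl)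
  ... | suc (suc d) = refl

  dropLast′ : Step → List Step → List Step
  dropLast′ p [] = []
  dropLast′ p (p′ ∷ ps) = p ∷ dropLast′ p′ ps

  dropLast : List Step → Maybe (List Step)
  dropLast [] = nothing
  dropLast (p ∷ ps) = just (dropLast′ p ps)

  length-dropLast′ : ∀ p ps → length (dropLast′ p ps) ≡ length ps
  length-dropLast′ p [] = refl
  length-dropLast′ p (p′ ∷ ps) = cong suc (length-dropLast′ p′ ps)

  cut-branch : ∀ p ps → cut (branch (p ∷ ps)) ≡ branch (dropLast′ p ps)
  cut-branch (φ , b) [] = cut-grandparent φ _ (rdepthL-snoc b (node []))
  cut-branch (φ , b) (p′ ∷ ps) = begin
    cut (node (φ ∷ʳ c))                          ≡⟨ cut-descend φ c c-deep ⟩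
    node (φ ∷ʳ cut c)                            ≡⟨ cong (λ z → node (φ ∷ʳ z)) (cut-descend b rest rest-deep) ⟩
    node (φ ∷ʳ node (b ∷ʳ cut rest))             ≡⟨ cong (λ z → node (φ ∷ʳ node (b ∷ʳ z))) (cut-branch p′ ps) ⟩
    branch ((φ , b) ∷ dropLast′ p′ ps)           ∎
    where
    rest = branch (p′ ∷ ps)
    c = node (b ∷ʳ rest)
    rest-deep : rdepth rest ≢ 1
    rest-deep e = 1+n≢0 (trans (sym (+-suc (length ps) (length ps)))
                               (suc-injective (trans (sym (rdepth-branch (p′ ∷ ps))) e)))
    c-deep : rdepth c ≢ 1
    c-deep e = 1+n≢0 (trans (sym (rdepth-branch (p′ ∷ ps)))
                            (suc-injective (trans (sym (rdepthL-snoc b rest)) e)))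

  reduceBranch-snoc : ∀ xs t → reduceBranch (node (xs ∷ʳ t)) ≡ just (cut (node (xs ∷ʳ t)))
  reduceBranch-snoc [] t = refl
  reduceBranch-snoc (x ∷ xs) t = refl

  reduceBranch-branch : ∀ ps → reduceBranch (branch ps) ≡ Data.Maybe.map branch (dropLast ps)
  reduceBranch-branch [] = refl
  reduceBranch-branch ((φ , b) ∷ ps) = trans (reduceBranch-snoc φ _) (cong just (cut-branch (φ , b) ps))

  ρ-branches : ∀ pss → ρ (node (map branch pss)) ≡ node (map branch (mapMaybe dropLast pss))
  ρ-branches pss = cong node (reduceAll pss)
    where
    reduceAll : ∀ pss → mapMaybe reduceBranch (map branch pss) ≡ map branch (mapMaybe dropLast pss)
    reduceAll [] = refl
    reduceAll (ps ∷ pss) with dropLast ps | reduceBranch-branch ps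
    ... | nothing | e rewrite e = reduceAll pss
    ... | just ps′ | e rewrite e = cong (branch ps′ ∷_) (reduceAll pss)

  ρ^-suc : ∀ r t → ρ^ (suc r) t ≡ ρ^ r (ρ t)
  ρ^-suc zero t = refl
  ρ^-suc (suc r) t = cong ρ (ρ^-suc r t)

  survives : ℕ → List Step → ℕ
  survives zero _ = 1
  survives (suc r) [] = 0
  survives (suc r) (_ ∷ ps) = survives r ps

  -- After r reductions a step is still present iff at least r steps follow it.
  stepWeights : ℕ → List Step → ℕ
  stepWeights r [] = 0
  stepWeights r (p ∷ ps) = stepSize p * survives r ps + stepWeights r ps

  branchSize : ℕ → List Step → ℕ
  branchSize r ps = survives r ps + stepWeights r ps

  survives-length : ∀ r xs ys → length xs ≡ length ys → survives r xs ≡ survives r ys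
  survives-length zero xs ys e = refl
  survives-length (suc r) [] [] e = refl
  survives-length (suc r) (x ∷ xs) (y ∷ ys) e = survives-length r xs ys (suc-injective e)

  stepWeights-dropLast : ∀ r p ps → stepWeights (suc r) (p ∷ ps) ≡ stepWeights r (dropLast′ p ps)
  stepWeights-dropLast r p [] = trans (+-identityʳ _) (*-zeroʳ (stepSize p))
  stepWeights-dropLast r p (p′ ∷ ps) = cong₂ _+_
    (cong (stepSize p *_) (survives-length r ps (dropLast′ p′ ps) (sym (length-dropLast′ p′ ps))))
    (stepWeights-dropLast r p′ ps)

  branchSize-suc : ∀ r ps → branchSize (suc r) ps ≡ maybe (branchSize r) 0 (dropLast ps)
  branchSize-suc r [] = refl
  branchSize-suc r (p ∷ ps) = cong₂ _+_
    (survives-length r ps (dropLast′ p ps) (sym (length-dropLast′ p ps))) (stepWeights-dropLast r p ps)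

  branchSize-zero : ∀ ps → branchSize 0 ps ≡ size (branch ps)
  branchSize-zero [] = refl
  branchSize-zero ((φ , b) ∷ ps) = begin
    suc (stepSize (φ , b) * 1 + stepWeights 0 ps)
      ≡⟨ arithmetic (sizeF φ) (sizeF b) (stepWeights 0 ps) ⟩
    suc (sizeF φ + suc (sizeF b + suc (stepWeights 0 ps)))
      ≡⟨ cong (λ z → suc (sizeF φ + suc (sizeF b + z))) (branchSize-zero ps) ⟩
    suc (sizeF φ + suc (sizeF b + size (branch ps)))
      ≡⟨ cong (λ z → suc (sizeF φ + suc z)) (sizeF-snoc b (branch ps)) ⟨
    suc (sizeF φ + size (node (b ∷ʳ branch ps)))
      ≡⟨ cong suc (sizeF-snoc φ _) ⟨
    size (branch ((φ , b) ∷ ps)) ∎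
    where
    arithmetic : ∀ x y w → suc (suc (suc (x + y)) * 1 + w) ≡ suc (x + suc (y + suc w))
    arithmetic = solve 3 (λ x y w → con 1 :+ ((con 2 :+ (x :+ y)) :* con 1 :+ w)
                                    := con 1 :+ (x :+ (con 1 :+ (y :+ (con 1 :+ w))))) refl

  sizeF-map : {A : Set} (g : A → Tree) (xs : List A) → sizeF (map g xs) ≡ ∑ (λ a → size (g a)) xs
  sizeF-map g [] = refl
  sizeF-map g (x ∷ xs) = cong (size (g x) +_) (sizeF-map g xs)

  ∑-dropLast : ∀ (φ : List Step → ℕ) pss →
    ∑ φ (mapMaybe dropLast pss) ≡ ∑ (λ ps → maybe φ 0 (dropLast ps)) pss
  ∑-dropLast φ [] = refl
  ∑-dropLast φ (ps ∷ pss) with dropLast ps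
  ... | nothing = ∑-dropLast φ pss
  ... | just ps′ = cong (φ ps′ +_) (∑-dropLast φ pss)

  size-ρ^-branches : ∀ r pss → size (ρ^ r (node (map branch pss))) ≡ suc (∑ (branchSize r) pss)
  size-ρ^-branches zero pss =
    cong suc (trans (sizeF-map branch pss) (∑-cong pss (λ ps _ → sym (branchSize-zero ps))))
  size-ρ^-branches (suc r) pss = begin
    size (ρ^ (suc r) (node (map branch pss)))
      ≡⟨ cong size (ρ^-suc r _) ⟩
    size (ρ^ r (ρ (node (map branch pss))))
      ≡⟨ cong (λ z → size (ρ^ r z)) (ρ-branches pss) ⟩
    size (ρ^ r (node (map branch (mapMaybe dropLast pss))))
      ≡⟨ size-ρ^-branches r _ ⟩
    suc (∑ (branchSize r) (mapMaybe dropLast pss))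
      ≡⟨ cong suc (∑-dropLast (branchSize r) pss) ⟩
    suc (∑ (λ ps → maybe (branchSize r) 0 (dropLast ps)) pss)
      ≡⟨ cong suc (∑-cong pss (λ ps _ → sym (branchSize-suc r ps))) ⟩
    suc (∑ (branchSize (suc r)) pss) ∎

module Encoding where

  open import Defs
  open import Data.Nat using (ℕ; zero; suc; _+_; _*_)
  open import Data.Nat.Properties
  open import Data.Product using (Σ; _×_; _,_; proj₁; proj₂)
  open import Data.Empty using (⊥-elim)
  open import Data.List using (List; []; _∷_; _++_; map; length; _∷ʳ_; initLast; _∷ʳ′_)
  open import Data.List.Properties using (∷ʳ-injective; map-injective; ∷-injective)
  open import Data.List.Membership.Propositional using (_∈_)
  open import Data.List.Membership.Propositional.Properties using (∈-map⁺; ∈-map⁻)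
  open import Data.List.Relation.Unary.All using (All; []; _∷_)
  open import Data.List.Relation.Unary.Unique.Propositional using (Unique)
  import Data.List.Relation.Unary.Unique.Propositional.Properties as Unique
  open import Function.Bundles using (_⇔_; mk⇔)
  open import Relation.Binary.PropositionalEquality
  open ≡-Reasoning
  open ListSums using (∑)
  open Forests using (forests; ∈-forests; forests-unique; forestsᵏ-size)
  open Branches

  -- A forest is cut at its leaves into segments; every internal tree
  -- node (node φ ∷ b) of a segment is read as the step (φ , b).  split f
  -- returns the first segment and the list of the following ones.
  split : List Tree → List Step × List (List Step)
  split [] = [] , []
  split (node [] ∷ h) = [] , (proj₁ (split h) ∷ proj₂ (split h))
  split (node (node φ ∷ b) ∷ h) = ((φ , b) ∷ proj₁ (split h)) , proj₂ (split h)

  segments : List Tree → List (List Step)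
  segments f = proj₁ (split f) ∷ proj₂ (split f)

  toCS : List Tree → Tree
  toCS f = node (map branch (segments f))

  firstInternal : ℕ → List Tree → ℕ
  firstInternal zero _ = 1
  firstInternal (suc r) [] = 0
  firstInternal (suc r) (node [] ∷ h) = 0
  firstInternal (suc r) (node (_ ∷ _) ∷ h) = firstInternal r h

  weighted : ℕ → List Tree → ℕ
  weighted r [] = 0
  weighted r (t ∷ h) = size t * firstInternal r h + weighted r h

  firstInternal-split : ∀ r h → firstInternal r h ≡ survives r (proj₁ (split h))
  firstInternal-split zero h = refl
  firstInternal-split (suc r) [] = refl
  firstInternal-split (suc r) (node [] ∷ h) = refl
  firstInternal-split (suc r) (node (node φ ∷ b) ∷ h) = firstInternal-split r h

  weighted-split : ∀ r h →
    weighted r h ≡ stepWeights r (proj₁ (split h)) + ∑ (branchSize r) (proj₂ (split h))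
  weighted-split r [] = refl
  weighted-split r (node [] ∷ h) = begin
    (firstInternal r h + 0) + weighted r h
      ≡⟨ cong₂ _+_ (trans (+-identityʳ _) (firstInternal-split r h)) (weighted-split r h) ⟩
    survives r c + (stepWeights r c + ∑ (branchSize r) later)
      ≡⟨ +-assoc (survives r c) _ _ ⟨
    branchSize r c + ∑ (branchSize r) later ∎
    where c = proj₁ (split h)
          later = proj₂ (split h)
  weighted-split r (node (node φ ∷ b) ∷ h) = begin
    stepSize (φ , b) * firstInternal r h + weighted r h
      ≡⟨ cong₂ _+_ (cong (stepSize (φ , b) *_) (firstInternal-split r h)) (weighted-split r h) ⟩
    stepSize (φ , b) * survives r c + (stepWeights r c + ∑ (branchSize r) later)
      ≡⟨ +-assoc (stepSize (φ , b) * survives r c) _ _ ⟨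
    stepWeights r ((φ , b) ∷ c) + ∑ (branchSize r) later ∎
    where c = proj₁ (split h)
          later = proj₂ (split h)

  ∑-branchSize-segments : ∀ r f → ∑ (branchSize r) (segments f) ≡ firstInternal r f + weighted r f
  ∑-branchSize-segments r f = begin
    (survives r c + stepWeights r c) + ∑ (branchSize r) later
      ≡⟨ +-assoc (survives r c) _ _ ⟩
    survives r c + (stepWeights r c + ∑ (branchSize r) later)
      ≡⟨ cong₂ _+_ (firstInternal-split r f) (weighted-split r f) ⟨
    firstInternal r f + weighted r f ∎
    where c = proj₁ (split f)
          later = proj₂ (split f)

  weighted-zero : ∀ f → weighted 0 f ≡ sizeF f
  weighted-zero [] = refl
  weighted-zero (t ∷ h) = cong₂ _+_ (*-identityʳ (size t)) (weighted-zero h)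

  size-ρ^-toCS : ∀ r f → size (ρ^ r (toCS f)) ≡ suc (firstInternal r f + weighted r f)
  size-ρ^-toCS r f = trans (size-ρ^-branches r (segments f)) (cong suc (∑-branchSize-segments r f))

  size-toCS : ∀ f → size (toCS f) ≡ suc (suc (sizeF f))
  size-toCS f = trans (size-ρ^-toCS 0 f) (cong (λ z → suc (suc z)) (weighted-zero f))

  joinSteps : List Step → List Tree
  joinSteps [] = []
  joinSteps ((φ , b) ∷ ps) = node (node φ ∷ b) ∷ joinSteps ps

  mutual
    join : List Step → List (List Step) → List Tree
    join c later = joinSteps c ++ joinLater later

    joinLater : List (List Step) → List Tree
    joinLater [] = []
    joinLater (c ∷ later) = node [] ∷ join c later

  split-join : ∀ c later → split (join c later) ≡ (c , later)
  split-join ((φ , b) ∷ c) later rewrite split-join c later = refl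
  split-join [] [] = refl
  split-join [] (c ∷ later) rewrite split-join c later = refl

  join-split : ∀ f → join (proj₁ (split f)) (proj₂ (split f)) ≡ f
  join-split [] = refl
  join-split (node [] ∷ h) = cong (node [] ∷_) (join-split h)
  join-split (node (node φ ∷ b) ∷ h) = cong (node (node φ ∷ b) ∷_) (join-split h)

  -- toCS is injective because branch is, and split has the inverse join.
  node-injective : ∀ {ts us} → node ts ≡ node us → ts ≡ us
  node-injective refl = refl

  snoc≢[] : {A : Set} (xs : List A) (x : A) → xs ∷ʳ x ≢ []
  snoc≢[] [] x ()
  snoc≢[] (y ∷ xs) x ()

  branch-injective : ∀ {ps ps′} → branch ps ≡ branch ps′ → ps ≡ ps′
  branch-injective {[]} {[]} e = refl
  branch-injective {[]} {(φ , b) ∷ ps′} e = ⊥-elim (snoc≢[] φ _ (sym (node-injective e)))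
  branch-injective {(φ , b) ∷ ps} {[]} e = ⊥-elim (snoc≢[] φ _ (node-injective e))
  branch-injective {(φ , b) ∷ ps} {(φ′ , b′) ∷ ps′} e
    with ∷ʳ-injective φ φ′ (node-injective e)
  ... | refl , e₁ with ∷ʳ-injective b b′ (node-injective e₁)
  ... | refl , e₂ = cong ((φ , b) ∷_) (branch-injective e₂)

  toCS-injective : ∀ {f f′} → toCS f ≡ toCS f′ → f ≡ f′
  toCS-injective {f} {f′} e with ∷-injective (map-injective branch-injective (node-injective e))
  ... | e₁ , e₂ = begin
    f                                     ≡⟨ join-split f ⟨
    join (proj₁ (split f)) (proj₂ (split f))   ≡⟨ cong₂ join e₁ e₂ ⟩
    join (proj₁ (split f′)) (proj₂ (split f′)) ≡⟨ join-split f′ ⟩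
    f′                                    ∎

  -- The root branches of a Catalan–Stanley tree are exactly the trees
  -- branch ps: their rightmost leaf is at odd distance from the root.
  branch-odd : ∀ ps → Odd (suc (rdepth (branch ps)))
  branch-odd ps = length ps , cong suc (trans (rdepth-branch ps) (cong (length ps +_) (sym (+-identityʳ (length ps)))))

  branch-surjective : ∀ k c → rdepth c ≡ k + k → Σ (List Step) λ ps → branch ps ≡ c
  branch-surjective zero (node cs) e with initLast cs
  ... | [] = [] , refl
  ... | xs ∷ʳ′ x = ⊥-elim (1+n≢0 (trans (sym (rdepthL-snoc xs x)) e))
  branch-surjective (suc k) (node cs) e with initLast cs
  ... | [] = ⊥-elim (1+n≢0 (sym e))
  ... | φ ∷ʳ′ y with y | trans (suc-injective (trans (sym (rdepthL-snoc φ y)) e)) (+-suc k k)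
  ...   | node ds | e₂ with initLast ds
  ...     | [] = ⊥-elim (1+n≢0 (sym e₂))
  ...     | b ∷ʳ′ z with branch-surjective k z (suc-injective (trans (sym (rdepthL-snoc b z)) e₂))
  ...       | ps , refl = ((φ , b) ∷ ps) , refl

  odd⇒branch : ∀ c → Odd (suc (rdepth c)) → Σ (List Step) λ ps → branch ps ≡ c
  odd⇒branch c (k , e) = branch-surjective k c (trans (suc-injective e) (cong (k +_) (+-identityʳ k)))

  odd⇒branches : ∀ ts → All (λ c → Odd (suc (rdepth c))) ts →
    Σ (List (List Step)) λ pss → map branch pss ≡ ts
  odd⇒branches [] [] = [] , refl
  odd⇒branches (t ∷ ts) (o ∷ os) with odd⇒branch t o | odd⇒branches ts os
  ... | ps , refl | pss , refl = (ps ∷ pss) , refl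

  branches-odd : ∀ pss → All (λ c → Odd (suc (rdepth c))) (map branch pss)
  branches-odd [] = []
  branches-odd (ps ∷ pss) = branch-odd ps ∷ branches-odd pss

  csTrees : ℕ → List Tree
  csTrees m = map toCS (forests m)

  csTrees-unique : ∀ m → Unique (csTrees m)
  csTrees-unique m = Unique.map⁺ toCS-injective (forests-unique m)

  csTrees-sound : ∀ m t → t ∈ csTrees m → CatalanStanley t × size t ≡ suc (suc m)
  csTrees-sound m t t∈ with ∈-map⁻ toCS t∈
  ... | f , f∈ , refl = branches-odd (segments f)
                      , trans (size-toCS f) (cong (λ z → suc (suc z)) (forestsᵏ-size (suc m) m f∈))

  csTrees-complete : ∀ m t → CatalanStanley t → size t ≡ suc (suc m) → t ∈ csTrees m
  csTrees-complete m (node ts) cs e with odd⇒branches ts cs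
  ... | [] , refl = ⊥-elim (1+n≢0 (suc-injective (sym e)))
  ... | (c ∷ later) , refl = subst (_∈ csTrees m) encodes (∈-map⁺ toCS f∈)
    where
    f = join c later
    encodes : toCS f ≡ node (map branch (c ∷ later))
    encodes = cong (λ z → node (map branch (proj₁ z ∷ proj₂ z))) (split-join c later)
    f-size : sizeF f ≡ m
    f-size = suc-injective (suc-injective (trans (sym (size-toCS f)) (trans (cong size encodes) e)))
    f∈ : f ∈ forests m
    f∈ = subst (λ z → f ∈ forests z) f-size (∈-forests f)

  csTrees-enumerates : ∀ m t → (t ∈ csTrees m) ⇔ (CatalanStanley t × size t ≡ suc (suc m))
  csTrees-enumerates m t = mk⇔ (csTrees-sound m t) (λ (cs , e) → csTrees-complete m t cs e)

module Binomials where

  open import Data.Nat using (ℕ; zero; suc; _+_; _*_; z≤n; s≤s)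
  open import Data.Nat.Properties
  open import Data.Nat.Combinatorics using (_C_; nCk+nC[k+1]≡[n+1]C[k+1]; nCk≡nC[n∸k]; nC1≡n)
  open import Data.Nat.Combinatorics.Specification using (k>n⇒nCk≡0)
  open import Relation.Binary.PropositionalEquality
  open ≡-Reasoning

  pascal : ∀ n k → suc n C suc k ≡ n C k + n C suc k
  pascal n k = sym (nCk+nC[k+1]≡[n+1]C[k+1] n k)

  -- prevC m k = m C (k - 1), taken to be 0 when k = 0.
  prevC : ℕ → ℕ → ℕ
  prevC m zero = 0
  prevC m (suc k) = m C k

  pascal′ : ∀ m k → suc m C k ≡ prevC m k + m C k
  pascal′ m zero = refl
  pascal′ m (suc k) = pascal m k

  absorption : ∀ n k → suc k * (suc n C suc k) ≡ suc n * (n C k)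
  absorption zero zero = refl
  absorption zero (suc k)
    rewrite k>n⇒nCk≡0 {1} {suc (suc k)} (s≤s (s≤s z≤n)) | k>n⇒nCk≡0 {0} {suc k} (s≤s z≤n)
    = *-zeroʳ (suc (suc k))
  absorption (suc n) zero =
    trans (+-identityʳ _) (trans (nC1≡n (suc (suc n))) (sym (*-identityʳ (suc (suc n)))))
  absorption (suc n) (suc k) = begin
    suc (suc k) * (suc (suc n) C suc (suc k))
      ≡⟨ cong (suc (suc k) *_) (pascal (suc n) (suc k)) ⟩
    suc (suc k) * (A + B)
      ≡⟨ *-distribˡ-+ (suc (suc k)) A B ⟩
    (A + suc k * A) + suc (suc k) * B
      ≡⟨ cong₂ (λ u v → (A + u) + v) (absorption n k) (absorption n (suc k)) ⟩
    (A + suc n * (n C k)) + suc n * (n C suc k)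
      ≡⟨ +-assoc A _ _ ⟩
    A + (suc n * (n C k) + suc n * (n C suc k))
      ≡⟨ cong (A +_) (*-distribˡ-+ (suc n) (n C k) (n C suc k)) ⟨
    A + suc n * (n C k + n C suc k)
      ≡⟨ cong (λ z → A + suc n * z) (pascal n k) ⟨
    A + suc n * A ∎
    where A = suc n C suc k
          B = suc n C suc (suc k)

  C-symmetric : ∀ j k → (j + k) C j ≡ (j + k) C k
  C-symmetric j k = trans (nCk≡nC[n∸k] (m≤m+n j k)) (cong ((j + k) C_) (m+n∸m≡n j k))

  -- N C(2N, N) = (N + 1) C(2N, N - 1), the identity behind the Catalan formula.
  central-absorption : ∀ N → N * ((N + N) C N) ≡ suc N * prevC (N + N) N
  central-absorption zero = refl
  central-absorption (suc N) = begin
    suc N * (M C suc N)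
      ≡⟨ cong (λ z → suc N * (z C suc N)) M≡ ⟩
    suc N * (suc (suc (N + N)) C suc N)
      ≡⟨ absorption (suc (N + N)) N ⟩
    suc (suc (N + N)) * (suc (N + N) C N)
      ≡⟨ cong (suc (suc (N + N)) *_) (C-symmetric (suc N) N) ⟨
    suc (suc (N + N)) * (suc (N + N) C suc N)
      ≡⟨ absorption (suc (N + N)) (suc N) ⟨
    suc (suc N) * (suc (suc (N + N)) C suc (suc N))
      ≡⟨ cong (suc (suc N) *_) (C-symmetric (suc (suc N)) N) ⟩
    suc (suc N) * (suc (suc (N + N)) C N)
      ≡⟨ cong (λ z → suc (suc N) * (z C N)) M≡ ⟨
    suc (suc N) * (M C N) ∎
    where M = suc N + suc N
          M≡ : M ≡ suc (suc (N + N))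
          M≡ = cong suc (+-suc N N)


module IntegerBinomials where

  open import Defs using (binomℤ)
  open import Data.Nat using (suc; _+_; _∸_; _<_; _≤?_)
  open import Data.Nat.Properties
  open import Data.Nat.Combinatorics using (_C_)
  open import Data.Nat.Combinatorics.Specification using (k>n⇒nCk≡0)
  open import Data.Integer using (+_; -_; _⊖_) renaming (_-_ to _-ℤ_)
  open import Data.Integer.Properties using ([+m]-[+n]≡m⊖n; ⊖-≥; ⊖-<)
  open import Relation.Nullary using (yes; no)
  open import Relation.Binary.PropositionalEquality
  open ≡-Reasoning

  binomℤ-shifted : ∀ b c j → binomℤ (+ (b + c) -ℤ + b) j ≡ c C j
  binomℤ-shifted b c j = cong (λ z → binomℤ z j) (begin
    + (b + c) -ℤ + b ≡⟨ [+m]-[+n]≡m⊖n (b + c) b ⟩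
    (b + c) ⊖ b      ≡⟨ ⊖-≥ (m≤m+n b c) ⟩
    + (b + c ∸ b)    ≡⟨ cong (λ x → + x) (m+n∸m≡n b c) ⟩
    + c              ∎)

  binomℤ-below : ∀ a b j → a < j + b → binomℤ (+ a -ℤ + b) j ≡ 0
  binomℤ-below a b j a<j+b with b ≤? a
  ... | yes b≤a = begin
    binomℤ (+ a -ℤ + b) j ≡⟨ cong (λ z → binomℤ z j) (trans ([+m]-[+n]≡m⊖n a b) (⊖-≥ b≤a)) ⟩
    (a ∸ b) C j           ≡⟨ k>n⇒nCk≡0 (+-cancelʳ-< b (a ∸ b) j (subst (_< j + b) (sym (m∸n+n≡m b≤a)) a<j+b)) ⟩
    0                     ∎
  ... | no b≰a = begin
    binomℤ (+ a -ℤ + b) j ≡⟨ cong (λ z → binomℤ z j) (trans ([+m]-[+n]≡m⊖n a b) (⊖-< (≰⇒> b≰a))) ⟩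
    binomℤ (- + (b ∸ a)) j ≡⟨ negative (b ∸ a) (m<n⇒0<n∸m (≰⇒> b≰a)) ⟩
    0                     ∎
    where
    negative : ∀ x → 0 < x → binomℤ (- + x) j ≡ 0
    negative (suc x) _ = refl

module ForestSeries where

  open import Defs
  open import Data.Nat using (ℕ; zero; suc; _+_; _*_)
  open import Data.Nat.Properties
  open import Data.List using (List; []; _∷_)
  open import Relation.Binary.PropositionalEquality
  open ≡-Reasoning
  open FormalSeries
  open ListSums
  open Forests
  open Encoding

  Cat : Seq
  Cat n = ∑ (λ _ → 1) (forests n)

  nonEmpty : List Tree → ℕ
  nonEmpty [] = 0
  nonEmpty (_ ∷ _) = 1

  NonEmpty : Seq
  NonEmpty n = ∑ nonEmpty (forests n)

  E : ℕ → Seq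
  E r n = ∑ (firstInternal r) (forests n)

  W : ℕ → Seq
  W r n = ∑ (weighted r) (forests n)

  Z : Seq
  Z n = ∑ (λ g → suc (sizeF g)) (forests n)

  -- S r n + Cat n is the total size of ρ^r over Catalan–Stanley trees of size n + 2.
  S : ℕ → Seq
  S r = E r ⊕ W r

  Cat-equation : Cat ≐ 𝟙 ⊕ X (Cat ⋆ Cat)
  Cat-equation zero = refl
  Cat-equation (suc n) = ∑-forests-plant (λ _ → 1) (λ _ → 1) (λ _ → 1) n (λ g h → refl)

  NonEmpty-equation : NonEmpty ≐ X (Cat ⋆ Cat)
  NonEmpty-equation zero = refl
  NonEmpty-equation (suc n) = ∑-forests-plant nonEmpty (λ _ → 1) (λ _ → 1) n (λ g h → refl)

  E-equation : ∀ r → E (suc r) ≐ X (NonEmpty ⋆ E r)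
  E-equation r zero = refl
  E-equation r (suc n) = ∑-forests-plant (firstInternal (suc r)) nonEmpty (firstInternal r) n factor
    where
    factor : ∀ g h → firstInternal (suc r) (node g ∷ h) ≡ nonEmpty g * firstInternal r h
    factor [] h = refl
    factor (_ ∷ _) h = sym (+-identityʳ (firstInternal r h))

  W-equation : ∀ r → W r ≐ X (Z ⋆ E r) ⊕ X (Cat ⋆ W r)
  W-equation r zero = refl
  W-equation r (suc n) = begin
    ∑ (weighted r) (forests (suc n))
      ≡⟨ ∑-cong (forests (suc n)) (λ f _ → weighted-first+rest f) ⟩
    ∑ (λ f → first f + rest f) (forests (suc n))
      ≡⟨ ∑-+ first rest (forests (suc n)) ⟩
    ∑ first (forests (suc n)) + ∑ rest (forests (suc n))
      ≡⟨ cong₂ _+_ (∑-forests-plant first (λ g → suc (sizeF g)) (firstInternal r) n (λ g h → refl))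
                   (∑-forests-plant rest (λ _ → 1) (weighted r) n (λ g h → sym (+-identityʳ (weighted r h)))) ⟩
    (Z ⋆ E r) n + (Cat ⋆ W r) n ∎
    where
    first rest : List Tree → ℕ
    first [] = 0
    first (t ∷ h) = size t * firstInternal r h
    rest [] = 0
    rest (t ∷ h) = weighted r h
    weighted-first+rest : ∀ f → weighted r f ≡ first f + rest f
    weighted-first+rest [] = refl
    weighted-first+rest (t ∷ h) = refl

  -- S 0 n = (n + 1) Cat n, as every forest of size n contributes 1 + n.
  S0-value : ∀ n → S 0 n ≡ suc n * Cat n
  S0-value n = cong (Cat n +_) (begin
    ∑ (weighted 0) (forests n)
      ≡⟨ ∑-cong (forests n) (λ f f∈ → trans (weighted-zero f)
                  (trans (forestsᵏ-size (suc n) n f∈) (sym (*-identityʳ n)))) ⟩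
    ∑ (λ _ → n * 1) (forests n)
      ≡⟨ ∑-scale n (λ _ → 1) (forests n) ⟩
    n * Cat n ∎)

module Factorisation where

  open import Data.Nat using (ℕ; zero; suc)
  open FormalSeries
  open ≐-Reasoning
  open ForestSeries

  Cat⋆-solves : ∀ A → Cat ⋆ A ≐ A ⊕ X (Cat ⋆ (Cat ⋆ A))
  Cat⋆-solves A = begin
    Cat ⋆ A                     ≈⟨ ⋆-congˡ A Cat-equation ⟩
    (𝟙 ⊕ X (Cat ⋆ Cat)) ⋆ A     ≈⟨ ⋆-distribʳ 𝟙 (X (Cat ⋆ Cat)) A ⟩
    𝟙 ⋆ A ⊕ X (Cat ⋆ Cat) ⋆ A   ≈⟨ ⊕-cong (⋆-identityˡ A) (⋆-Xˡ (Cat ⋆ Cat) A) ⟩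
    A ⊕ X ((Cat ⋆ Cat) ⋆ A)     ≈⟨ ⊕-cong ≐-refl (X-cong (⋆-assoc Cat Cat A)) ⟩
    A ⊕ X (Cat ⋆ (Cat ⋆ A))     ∎

  W-closed : ∀ r → W r ≐ Cat ⋆ X (Z ⋆ E r)
  W-closed r = recursion-unique Cat (X (Z ⋆ E r)) (W r) _ (W-equation r) (Cat⋆-solves _)

  K : Seq
  K = 𝟙 ⊕ X (Cat ⋆ Z)

  S-factor : ∀ r → S r ≐ K ⋆ E r
  S-factor r = begin
    E r ⊕ W r                        ≈⟨ ⊕-cong ≐-refl (W-closed r) ⟩
    E r ⊕ Cat ⋆ X (Z ⋆ E r)          ≈⟨ ⊕-cong ≐-refl (⋆-Xʳ Cat (Z ⋆ E r)) ⟩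
    E r ⊕ X (Cat ⋆ (Z ⋆ E r))        ≈⟨ ⊕-cong ≐-refl (X-cong (⋆-assoc Cat Z (E r))) ⟨
    E r ⊕ X ((Cat ⋆ Z) ⋆ E r)        ≈⟨ ⊕-cong (⋆-identityˡ (E r)) (⋆-Xˡ (Cat ⋆ Z) (E r)) ⟨
    𝟙 ⋆ E r ⊕ X (Cat ⋆ Z) ⋆ E r      ≈⟨ ⋆-distribʳ 𝟙 (X (Cat ⋆ Z)) (E r) ⟨
    K ⋆ E r                          ∎

  -- Each further required internal tree contributes a factor N = x NonEmpty.
  N : Seq
  N = X NonEmpty

  E-power : ∀ r → E r ≐ (N ^ r) ⋆ Cat
  E-power zero = ≐-sym (⋆-identityˡ Cat)
  E-power (suc r) = begin
    E (suc r)              ≈⟨ E-equation r ⟩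
    X (NonEmpty ⋆ E r)     ≈⟨ ⋆-Xˡ NonEmpty (E r) ⟨
    N ⋆ E r                ≈⟨ ⋆-congʳ N (E-power r) ⟩
    N ⋆ ((N ^ r) ⋆ Cat)    ≈⟨ ⋆-assoc N (N ^ r) Cat ⟨
    (N ^ suc r) ⋆ Cat      ∎

  S-power : ∀ r → S r ≐ (N ^ r) ⋆ S 0
  S-power r = begin
    S r              ≈⟨ S-factor r ⟩
    K ⋆ E r          ≈⟨ ⋆-congʳ K (E-power r) ⟩
    K ⋆ (P ⋆ Cat)    ≈⟨ ⋆-assoc K P Cat ⟨
    (K ⋆ P) ⋆ Cat    ≈⟨ ⋆-congˡ Cat (⋆-comm K P) ⟩
    (P ⋆ K) ⋆ Cat    ≈⟨ ⋆-assoc P K Cat ⟩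
    P ⋆ (K ⋆ Cat)    ≈⟨ ⋆-congʳ P (S-factor 0) ⟨
    P ⋆ S 0          ∎
    where P = N ^ r

  -- twice r = 2r, defined so that twice (r + 1) reduces to twice r + 2.
  twice : ℕ → ℕ
  twice zero = 0
  twice (suc r) = suc (suc (twice r))

  -- N = x² Cat², so N ^ r = x^(2r) Cat^(2r).
  N^-shift : ∀ r G → (N ^ r) ⋆ G ≐ X^ (twice r) ((Cat ^ twice r) ⋆ G)
  N^-shift zero G = ≐-refl
  N^-shift (suc r) G = begin
    (N ^ suc r) ⋆ G          ≈⟨ ⋆-assoc N (N ^ r) G ⟩
    N ⋆ ((N ^ r) ⋆ G)        ≈⟨ ⋆-congʳ N (N^-shift r G) ⟩
    N ⋆ X^ d (P ⋆ G)         ≈⟨ ⋆-X^ʳ d N (P ⋆ G) ⟩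
    X^ d (N ⋆ (P ⋆ G))       ≈⟨ X^-cong d N⋆ ⟩
    X^ d (X (X (P₂ ⋆ G)))    ≈⟨ X^-X d _ ⟩
    X (X^ d (X (P₂ ⋆ G)))    ≈⟨ X-cong (X^-X d _) ⟩
    X (X (X^ d (P₂ ⋆ G)))    ∎
    where
    d = twice r
    P = Cat ^ d
    P₂ = Cat ^ suc (suc d)
    N⋆ : N ⋆ (P ⋆ G) ≐ X (X (P₂ ⋆ G))
    N⋆ = begin
      X NonEmpty ⋆ (P ⋆ G)            ≈⟨ ⋆-Xˡ NonEmpty (P ⋆ G) ⟩
      X (NonEmpty ⋆ (P ⋆ G))          ≈⟨ X-cong (⋆-congˡ (P ⋆ G) NonEmpty-equation) ⟩
      X (X (Cat ⋆ Cat) ⋆ (P ⋆ G))     ≈⟨ X-cong (⋆-Xˡ (Cat ⋆ Cat) (P ⋆ G)) ⟩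
      X (X ((Cat ⋆ Cat) ⋆ (P ⋆ G)))   ≈⟨ X-cong (X-cong (⋆-assoc (Cat ⋆ Cat) P G)) ⟨
      X (X (((Cat ⋆ Cat) ⋆ P) ⋆ G))   ≈⟨ X-cong (X-cong (⋆-congˡ G (⋆-assoc Cat Cat P))) ⟩
      X (X (P₂ ⋆ G))                  ∎

  Cat^-equation : ∀ k → Cat ^ suc k ≐ Cat ^ k ⊕ X (Cat ^ suc (suc k))
  Cat^-equation k = Cat⋆-solves (Cat ^ k)

  R : ℕ → Seq
  R k = (Cat ^ k) ⋆ S 0

  R-equation : ∀ k → R (suc k) ≐ R k ⊕ X (R (suc (suc k)))
  R-equation k = begin
    (Cat ^ suc k) ⋆ S 0                          ≈⟨ ⋆-congˡ (S 0) (Cat^-equation k) ⟩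
    (Cat ^ k ⊕ X (Cat ^ suc (suc k))) ⋆ S 0      ≈⟨ ⋆-distribʳ (Cat ^ k) _ (S 0) ⟩
    R k ⊕ X (Cat ^ suc (suc k)) ⋆ S 0            ≈⟨ ⊕-cong ≐-refl (⋆-Xˡ _ (S 0)) ⟩
    R k ⊕ X (R (suc (suc k)))                    ∎

module Coefficients where

  open import Data.Nat using (ℕ; zero; suc; _+_; _*_; _<_)
  open import Data.Nat.Properties
  open import Data.Nat.Combinatorics using (_C_)
  open import Data.Nat.Solver using (module +-*-Solver)
  open +-*-Solver using (solve; _:+_; _:=_; con)
  open import Relation.Binary.PropositionalEquality
  open ≡-Reasoning
  open FormalSeries
  open Binomials
  open ForestSeries
  open Factorisation

  Cat^-zero : ∀ k → (Cat ^ k) 0 ≡ 1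
  Cat^-zero zero = refl
  Cat^-zero (suc k) = cong (1 *_) (Cat^-zero k)

  B : ℕ → ℕ → ℕ
  B N k = (N + N + k) C N

  ballot : ∀ N k → (Cat ^ suc k) N + prevC (N + N + k) N ≡ B N k
  ballot zero k = trans (+-identityʳ _) (Cat^-zero (suc k))
  ballot (suc N) zero = begin
    (Cat ^ 1) (suc N) + prevC (suc N + suc N + 0) (suc N)
      ≡⟨ cong₂ _+_ (Cat^-equation 0 (suc N)) (cong (_C N) two) ⟩
    (Cat ^ 2) N + (suc (suc (N + N)) C N)
      ≡⟨ cong ((Cat ^ 2) N +_) (pascal′ (suc (N + N)) N) ⟩
    (Cat ^ 2) N + (prevC (suc (N + N)) N + (suc (N + N) C N))
      ≡⟨ +-assoc ((Cat ^ 2) N) _ _ ⟨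
    ((Cat ^ 2) N + prevC (suc (N + N)) N) + (suc (N + N) C N)
      ≡⟨ cong (λ z → ((Cat ^ 2) N + prevC z N) + (suc (N + N) C N)) (+-comm 1 (N + N)) ⟩
    ((Cat ^ 2) N + prevC (N + N + 1) N) + (suc (N + N) C N)
      ≡⟨ cong (_+ (suc (N + N) C N)) (ballot N 1) ⟩
    ((N + N + 1) C N) + (suc (N + N) C N)
      ≡⟨ cong₂ _+_ (cong (_C N) (+-comm 1 (N + N))) (C-symmetric (suc N) N) ⟨
    (suc (N + N) C N) + (suc (N + N) C suc N)
      ≡⟨ pascal (suc (N + N)) N ⟨
    suc (suc (N + N)) C suc N
      ≡⟨ cong (_C suc N) two ⟨
    B (suc N) zero ∎
    where two : suc N + suc N + 0 ≡ suc (suc (N + N))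
          two = trans (+-identityʳ _) (cong suc (+-suc N N))
  ballot (suc N) (suc k) = begin
    (Cat ^ (2 + k)) (suc N) + prevC (suc N + suc N + suc k) (suc N)
      ≡⟨ cong₂ _+_ (Cat^-equation (suc k) (suc N)) (cong (_C N) (+-suc (suc N + suc N) k)) ⟩
    ((Cat ^ suc k) (suc N) + (Cat ^ (3 + k)) N) + (suc m C N)
      ≡⟨ cong (((Cat ^ suc k) (suc N) + (Cat ^ (3 + k)) N) +_) (pascal′ m N) ⟩
    ((Cat ^ suc k) (suc N) + (Cat ^ (3 + k)) N) + (prevC m N + m C N)
      ≡⟨ rearrange ((Cat ^ suc k) (suc N)) ((Cat ^ (3 + k)) N) (prevC m N) (m C N) ⟩
    ((Cat ^ suc k) (suc N) + m C N) + ((Cat ^ (3 + k)) N + prevC m N)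
      ≡⟨ cong₂ _+_ (ballot (suc N) k) (trans (cong (λ z → (Cat ^ (3 + k)) N + prevC z N) (sym m≡))
                                              (trans (ballot N (2 + k)) (cong (_C N) m≡))) ⟩
    (m C suc N) + (m C N)
      ≡⟨ +-comm (m C suc N) _ ⟩
    (m C N) + (m C suc N)
      ≡⟨ pascal m N ⟨
    suc m C suc N
      ≡⟨ cong (_C suc N) (+-suc (suc N + suc N) k) ⟨
    B (suc N) (suc k) ∎
    where
    m = suc N + suc N + k
    m≡ : N + N + (2 + k) ≡ m
    m≡ = solve 2 (λ N k → N :+ N :+ (con 2 :+ k) := (con 1 :+ N) :+ (con 1 :+ N) :+ k) refl N k
    rearrange : ∀ a b c d → (a + b) + (c + d) ≡ (a + d) + (b + c)
    rearrange = solve 4 (λ a b c d → (a :+ b) :+ (c :+ d) := (a :+ d) :+ (b :+ c)) refl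

  catalan-formula : ∀ N → suc N * Cat N ≡ (N + N) C N
  catalan-formula N = +-cancelʳ-≡ _ _ _ (begin
    suc N * Cat N + suc N * c    ≡⟨ *-distribˡ-+ (suc N) (Cat N) c ⟨
    suc N * (Cat N + c)          ≡⟨ cong (λ z → suc N * (z + c)) (⋆-identityʳ Cat N) ⟨
    suc N * ((Cat ^ 1) N + c)    ≡⟨ cong (suc N *_) ballot₀ ⟩
    suc N * C₀                   ≡⟨ cong (C₀ +_) (central-absorption N) ⟩
    C₀ + suc N * c               ∎)
    where
    c = prevC (N + N) N
    C₀ = (N + N) C N
    ballot₀ : (Cat ^ 1) N + c ≡ C₀
    ballot₀ = begin
      (Cat ^ 1) N + c                   ≡⟨ cong (λ z → (Cat ^ 1) N + prevC z N) (+-identityʳ (N + N)) ⟨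
      (Cat ^ 1) N + prevC (N + N + 0) N ≡⟨ ballot N 0 ⟩
      B N 0                             ≡⟨ cong (_C N) (+-identityʳ (N + N)) ⟩
      C₀                                ∎

  S0-central : ∀ n → S 0 n ≡ B n 0
  S0-central n = trans (S0-value n) (trans (catalan-formula n) (cong (_C n) (sym (+-identityʳ (n + n)))))

  -- R k M = C(2M + k, M): both sides satisfy the Pascal recursion
  -- R (k+1) (M+1) = R k (M+1) + R (k+2) M.
  R-value : ∀ M k → R k M ≡ B M k
  R-value zero k = cong₂ _*_ (Cat^-zero k) (S0-central 0)
  R-value (suc M) zero = trans (⋆-identityˡ (S 0) (suc M)) (S0-central (suc M))
  R-value (suc M) (suc k) = begin
    R (suc k) (suc M)                    ≡⟨ R-equation k (suc M) ⟩
    R k (suc M) + R (2 + k) M            ≡⟨ cong₂ _+_ (R-value (suc M) k) (R-value M (2 + k)) ⟩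
    (m C suc M) + ((M + M + (2 + k)) C M) ≡⟨ cong (λ z → (m C suc M) + (z C M)) m≡ ⟩
    (m C suc M) + (m C M)                ≡⟨ +-comm (m C suc M) _ ⟩
    (m C M) + (m C suc M)                ≡⟨ pascal m M ⟨
    suc m C suc M                        ≡⟨ cong (_C suc M) (+-suc (suc M + suc M) k) ⟨
    B (suc M) (suc k)                    ∎
    where
    m = suc M + suc M + k
    m≡ : M + M + (2 + k) ≡ m
    m≡ = solve 2 (λ N k → N :+ N :+ (con 2 :+ k) := (con 1 :+ N) :+ (con 1 :+ N) :+ k) refl M k

  S-value-high : ∀ r M → S r (twice r + M) ≡ B M (twice r)
  S-value-high r M = begin
    S r (twice r + M)                                   ≡⟨ S-power r (twice r + M) ⟩
    ((N ^ r) ⋆ S 0) (twice r + M)                       ≡⟨ N^-shift r (S 0) (twice r + M) ⟩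
    X^ (twice r) (R (twice r)) (twice r + M)            ≡⟨ X^-shifted (twice r) _ M ⟩
    R (twice r) M                                       ≡⟨ R-value M (twice r) ⟩
    B M (twice r)                                       ∎

  S-value-low : ∀ r m → m < twice r → S r m ≡ 0
  S-value-low r m lt =
    trans (S-power r m) (trans (N^-shift r (S 0) m) (X^-low (twice r) _ m lt))

open import Defs
open import Data.Nat using (ℕ; _+_; _*_; _∸_; _≤_)
open import Data.Integer using (+_) renaming (_-_ to _-ℤ_)
open import Data.List using (List; map; length)
open import Data.Nat.ListAction using (sum)
open import Data.List.Membership.Propositional using (_∈_)
open import Data.List.Relation.Unary.Unique.Propositional using (Unique)
open import Data.Product using (_×_)
open import Function.Bundles using (_⇔_)
open import Relation.Binary.PropositionalEquality using (_≡_)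

open import Data.Nat using (zero; suc; s≤s; _<_; _≤?_; _/_)
open import Data.Nat.Properties
open import Data.Nat.DivMod using (m*n/n≡m)
open import Data.Nat.Combinatorics using (_C_)
open import Data.Nat.Solver using (module +-*-Solver)
open +-*-Solver using (solve; _:+_; _:*_; _:=_; con)
open import Data.List.Properties using (length-map)
open import Data.Product using (_,_)
import Function.Properties.Equivalence as ⇔
open import Relation.Nullary using (yes; no)
open import Relation.Binary.PropositionalEquality using (refl; sym; trans; cong; cong₂; subst; subst₂)
open Relation.Binary.PropositionalEquality.≡-Reasoning
open ListSums
open Forests using (forests)
open Encoding
open Binomials using (C-symmetric)
open IntegerBinomials
open ForestSeries
open Factorisation using (twice)
open Coefficients

twice≡ : ∀ r → twice r ≡ r + r
twice≡ zero = refl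
twice≡ (suc r) = cong suc (trans (cong suc (twice≡ r)) (sym (+-suc r r)))

binomℤ≡S-low : ∀ r m → m < twice r → binomℤ (+ (2 * suc (suc m)) -ℤ + (2 * r + 4)) m ≡ S r m
binomℤ≡S-low r m m<2r = trans (binomℤ-below _ _ m top<) (sym (S-value-low r m m<2r))
  where
  left : ∀ m → 2 * suc (suc m) ≡ m + (m + 4)
  left = solve 1 (λ m → con 2 :* (con 2 :+ m) := m :+ (m :+ con 4)) refl
  right : ∀ m r → m + (2 * r + 4) ≡ m + (r + r + 4)
  right = solve 2 (λ m r → m :+ (con 2 :* r :+ con 4) := m :+ (r :+ r :+ con 4)) refl
  top< : 2 * suc (suc m) < m + (2 * r + 4)
  top< = subst₂ _<_ (sym (left m)) (sym (right m r))
                (+-monoʳ-< m (+-monoˡ-< 4 (subst (m <_) (twice≡ r) m<2r)))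

binomℤ≡S-high : ∀ r M → let m = twice r + M in
  binomℤ (+ (2 * suc (suc m)) -ℤ + (2 * r + 4)) m ≡ S r m
binomℤ≡S-high r M = begin
  binomℤ (+ (2 * suc (suc (d + M))) -ℤ + (2 * r + 4)) (d + M)
    ≡⟨ cong (λ z → binomℤ (+ z -ℤ + (2 * r + 4)) (d + M)) top ⟩
  binomℤ (+ ((2 * r + 4) + ((d + M) + M)) -ℤ + (2 * r + 4)) (d + M)
    ≡⟨ binomℤ-shifted (2 * r + 4) ((d + M) + M) (d + M) ⟩
  ((d + M) + M) C (d + M)
    ≡⟨ C-symmetric (d + M) M ⟩
  ((d + M) + M) C M
    ≡⟨ cong (_C M) (trans (+-comm (M + M) d) (sym (+-assoc d M M))) ⟨
  B M d
    ≡⟨ S-value-high r M ⟨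
  S r (d + M) ∎
  where
  d = twice r
  top : 2 * suc (suc (d + M)) ≡ (2 * r + 4) + ((d + M) + M)
  top rewrite twice≡ r = solve 2 (λ r M → con 2 :* (con 2 :+ ((r :+ r) :+ M))
                                         := (con 2 :* r :+ con 4) :+ (((r :+ r) :+ M) :+ M)) refl r M

binomℤ≡S : ∀ r m → binomℤ (+ (2 * suc (suc m)) -ℤ + (2 * r + 4)) m ≡ S r m
binomℤ≡S r m with twice r ≤? m
... | no 2r≰m = binomℤ≡S-low r m (≰⇒> 2r≰m)
... | yes 2r≤m with m≤n⇒∃[o]m+o≡n 2r≤m
...   | M , refl = binomℤ≡S-high r M

catalan≡Cat : ∀ m → catalan m ≡ Cat m
catalan≡Cat m = begin
  ((2 * m) C m) / suc m   ≡⟨ cong (λ z → (z C m) / suc m) (cong (λ z → m + z) (+-identityʳ m)) ⟩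
  ((m + m) C m) / suc m   ≡⟨ cong (_/ suc m) (trans (sym (catalan-formula m)) (*-comm (suc m) (Cat m))) ⟩
  (Cat m * suc m) / suc m ≡⟨ m*n/n≡m (Cat m) (suc m) ⟩
  Cat m                   ∎

∑-size-ρ^ : ∀ r m → ∑ (λ t → size (ρ^ r t)) (csTrees m) ≡ Cat m + S r m
∑-size-ρ^ r m = begin
  ∑ (λ t → size (ρ^ r t)) (map toCS (forests m))
    ≡⟨ ∑-map _ toCS (forests m) ⟩
  ∑ (λ f → size (ρ^ r (toCS f))) (forests m)
    ≡⟨ ∑-cong (forests m) (λ f _ → size-ρ^-toCS r f) ⟩
  ∑ (λ f → 1 + (firstInternal r f + weighted r f)) (forests m)
    ≡⟨ ∑-+ (λ _ → 1) (λ f → firstInternal r f + weighted r f) (forests m) ⟩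
  Cat m + ∑ (λ f → firstInternal r f + weighted r f) (forests m)
    ≡⟨ cong (λ z → Cat m + z) (∑-+ (firstInternal r) (weighted r) (forests m)) ⟩
  Cat m + S r m ∎

length-csTrees : ∀ m → length (csTrees m) ≡ Cat m
length-csTrees m = trans (length-map toCS (forests m)) (sym (∑-count (forests m)))

-- With n = m + 2 both sides equal Cat m (Cat m + S r m), Cat m being the
-- number of trees in L.  (The argument does not need the hypothesis 1 ≤ r.)
mainTheorem12 : (n r : ℕ) → 2 ≤ n → 1 ≤ r →
    (L : List Tree) → Unique L →
    ((t : Tree) → (t ∈ L) ⇔ (CatalanStanley t × size t ≡ n)) →
    sum (map (λ t → size (ρ^ r t)) L) * catalan (n ∸ 2)
      ≡ length L * (binomℤ ((+ (2 * n)) -ℤ (+ (2 * r + 4))) (n ∸ 2) + catalan (n ∸ 2))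
mainTheorem12 (suc (suc m)) r (s≤s (s≤s _)) _ L L-unique L-enumerates = begin
  ∑ sizeρ^ L * catalan m        ≡⟨ cong₂ _*_ (trans (same-sum sizeρ^) (∑-size-ρ^ r m)) (catalan≡Cat m) ⟩
  (Cat m + S r m) * Cat m       ≡⟨ *-comm (Cat m + S r m) (Cat m) ⟩
  Cat m * (Cat m + S r m)       ≡⟨ cong₂ _*_ (sym same-length) (+-comm (Cat m) (S r m)) ⟩
  length L * (S r m + Cat m)    ≡⟨ cong (length L *_) (cong₂ _+_ (sym (binomℤ≡S r m)) (sym (catalan≡Cat m))) ⟩
  length L * (binomℤ (+ (2 * suc (suc m)) -ℤ + (2 * r + 4)) m + catalan m) ∎
  where
  sizeρ^ : Tree → ℕ
  sizeρ^ t = size (ρ^ r t)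
  same-sum : (φ : Tree → ℕ) → ∑ φ L ≡ ∑ φ (csTrees m)
  same-sum φ = ∑-unique φ L-unique (csTrees-unique m)
    (λ {t} → ⇔.trans (L-enumerates t) (⇔.sym (csTrees-enumerates m t)))
  same-length : length L ≡ Cat m
  same-length = trans (sym (∑-count L)) (trans (same-sum (λ _ → 1)) (trans (∑-count (csTrees m)) (length-csTrees m)))
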